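{- Let $k\geq 1$, $n=8k+r$ with $r\in\{2,5\}$, $G=C(n,\pm\{1,2,3,4\})$, $a\in\mathbb{Z}_n$, and let $A=(\{a,a+1,a+2\},\{a+3,a+5,a+6,a+8\})$ (indices mod $n$) be an $S$-cluster for some $S\subseteq V(G)$. If $X\subseteq V(G)$ resolves $A$, then $|X|\geq 3$.
   Context: $C(n,\pm\{1,2,3,4\})$ is the graph on $\mathbb{Z}_n$ where distinct $i,j$ are adjacent iff $j-i\equiv\pm s\pmod n$ for some $s\in\{1,2,3,4\}$; $d$ is graph distance, and $r(v|X)=(d(v,x))_{x\in X}$. For $S\subseteq V$, a set $B$ is an $S$-block if $r(a|S)=r(b|S)$ for all $a,b\in B$. A tuple $(A_1,\dots,A_p)$ of $S$-blocks is an $S$-cluster if the $A_i$ are contained in distinct equivalence classes of $u\sim_S v\iff r(u|S)=r(v|S)$. A set $X$ resolves a tuple $(A_1,\dots,A_p)$ if $r(a|X)\neq r(b|X)$ for all distinct $a,b$ in the same $A_j$. -}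

module Defs where

open import Data.Nat using (ℕ; zero; suc; _+_; _*_; _∸_; _≤_; NonZero)
open import Data.Nat.DivMod using (_%_; m%n<n)
open import Data.Fin using (Fin; toℕ; fromℕ<)
open import Data.Fin.Subset using (Subset; _∈_)
open import Data.List using (List; map; _∷_; [])
import Data.List.Membership.Propositional as LM
open import Data.Product using (_×_; Σ; ∃)
open import Data.Sum using (_⊎_)
open import Relation.Binary.PropositionalEquality using (_≡_; _≢_)
open import Function.Bundles using (_⇔_)
open import Relation.Nullary using (¬_)

module Circ (n : ℕ) .{{_ : NonZero n}} where

  _⊕_ : Fin n → ℕ → Fin n
  i ⊕ m = fromℕ< (m%n<n (toℕ i + m) n)

  diff : Fin n → Fin n → ℕ
  diff i j = (toℕ j + (n ∸ toℕ i)) % n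

  Adj : Fin n → Fin n → Set
  Adj i j = i ≢ j × Σ ℕ (λ s → (1 ≤ s × s ≤ 4) ×
              (diff i j ≡ s % n ⊎ diff i j ≡ (n ∸ (s % n)) % n))

  data Walk : Fin n → Fin n → ℕ → Set where
    here : ∀ {u} → Walk u u zero
    step : ∀ {u v w m} → Adj u v → Walk v w m → Walk u w (suc m)

  Dist : Fin n → Fin n → ℕ → Set
  Dist u v m = Walk u v m × (∀ m' → Walk u v m' → m ≤ m')

  SameRep : Subset n → Fin n → Fin n → Set
  SameRep X u v = ∀ x → x ∈ X → ∀ m → (Dist u x m ⇔ Dist v x m)

  IsBlock : Subset n → List (Fin n) → Set
  IsBlock S B = ∀ u v → u LM.∈ B → v LM.∈ B → SameRep S u v

  IsCluster2 : Subset n → List (Fin n) → List (Fin n) → Set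
  IsCluster2 S A₁ A₂ = IsBlock S A₁ × IsBlock S A₂ ×
    (∀ u v → u LM.∈ A₁ → v LM.∈ A₂ → ¬ SameRep S u v)

  Resolves2 : Subset n → List (Fin n) → List (Fin n) → Set
  Resolves2 X A₁ A₂ =
    (∀ u v → u LM.∈ A₁ → v LM.∈ A₁ → u ≢ v → ¬ SameRep X u v) ×
    (∀ u v → u LM.∈ A₂ → v LM.∈ A₂ → u ≢ v → ¬ SameRep X u v)

  clusterA₁ : Fin n → List (Fin n)
  clusterA₁ a = map (a ⊕_) (0 ∷ 1 ∷ 2 ∷ [])

  clusterA₂ : Fin n → List (Fin n)
  clusterA₂ a = map (a ⊕_) (3 ∷ 5 ∷ 6 ∷ 8 ∷ [])

-- In C(n, ±{1,2,3,4}) the distance between two vertices is ⌈c/4⌉, where c is the length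
-- of the shorter arc joining them.  Hence a vertex a + t sees the window a, …, a + 8
-- through the profile i ↦ ⌈arc(t − i)/4⌉, and only equalities between its values matter.
-- Up to an additive constant there are finitely many such profiles: landmarks inside the
-- window (for k = 1 on the cycle of length 8 + r itself), and landmarks outside it, whose
-- profile depends only on their distances A, B to the two ends of the window modulo 4 and
-- on the difference of A div 4 and B div 4 capped at 3; moreover A + B = n − 8 ≡ r (mod 4).
-- A finite computation shows that any two of these profiles take equal values on both
-- vertices of some pair inside A₁ or inside A₂, so no two vertices resolve A.

module Submission where

open import Defs
open import Data.Nat
  using (ℕ; zero; suc; _+_; _*_; _∸_; _≤_; _<_; _⊓_; ∣_-_∣; _/_; _%_; z≤n; s≤s; _≟_; _<?_; _≤?_; NonZero)
open import Data.Nat.Properties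
open import Data.Nat.DivMod
open import Data.Nat.Divisibility using (divides)
open import Data.Nat.Tactic.RingSolver using (solve-∀)
open import Data.Fin using (Fin; toℕ; zero; suc; #_)
open import Data.Fin.Properties using (toℕ-fromℕ<; toℕ-injective; toℕ<n)
open import Data.Fin.Subset using (Subset; ∣_∣; inside; outside) renaming (_∈_ to _∈ₛ_)
open import Data.Vec.Base using ([]; _∷_; here; there)
open import Data.List using (List; []; _∷_; map; upTo; _++_; length; concatMap; filter; cartesianProduct)
open import Data.List.Properties using (length-map)
open import Data.List.Relation.Unary.All as All using (All)
open import Data.List.Relation.Unary.Any as Any using (Any; here; there)
open import Data.List.Membership.Propositional using (_∈_; find)
open import Data.List.Membership.Propositional.Properties using (∈-upTo⁺; ∈-map⁺; ∈-map⁻; ∈-++⁻)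
open import Data.Product using (∃; ∃₂; _×_; _,_; proj₁; proj₂)
import Data.Product as Product
open import Data.Sum using (_⊎_; inj₁; inj₂; [_,_]′)
open import Data.Empty using (⊥)
open import Function.Bundles using (mk⇔)
open import Relation.Binary.PropositionalEquality
open import Relation.Nullary using (¬_; Dec; yes; no)
open import Relation.Nullary.Decidable using (_×-dec_; _→-dec_; from-yes)

open ≡-Reasoning

⌈_/4⌉ : ℕ → ℕ
⌈ x /4⌉ = (x + 3) / 4

⌈/4⌉-mono-≤ : ∀ {x y} → x ≤ y → ⌈ x /4⌉ ≤ ⌈ y /4⌉
⌈/4⌉-mono-≤ x≤y = /-monoˡ-≤ 4 (+-monoˡ-≤ 3 x≤y)

⌈/4⌉-distrib-⊓ : ∀ x y → ⌈ x ⊓ y /4⌉ ≡ ⌈ x /4⌉ ⊓ ⌈ y /4⌉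
⌈/4⌉-distrib-⊓ = mono-≤-distrib-⊓ {⌈_/4⌉} ⌈/4⌉-mono-≤

⌈m*4+x/4⌉≡m+⌈x/4⌉ : ∀ m x → ⌈ m * 4 + x /4⌉ ≡ m + ⌈ x /4⌉
⌈m*4+x/4⌉≡m+⌈x/4⌉ m x = begin
  (m * 4 + x + 3) / 4      ≡⟨ /-congˡ (+-assoc (m * 4) x 3) ⟩
  (m * 4 + (x + 3)) / 4    ≡⟨ +-distrib-/-∣ˡ (x + 3) (divides m refl) ⟩
  m * 4 / 4 + (x + 3) / 4  ≡⟨ cong (_+ ⌈ x /4⌉) (m*n/n≡m m 4) ⟩
  m + ⌈ x /4⌉              ∎

⌈m*4/4⌉≡m : ∀ m → ⌈ m * 4 /4⌉ ≡ m
⌈m*4/4⌉≡m m = begin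
  ⌈ m * 4 /4⌉      ≡⟨ cong ⌈_/4⌉ (+-identityʳ (m * 4)) ⟨
  ⌈ m * 4 + 0 /4⌉  ≡⟨ ⌈m*4+x/4⌉≡m+⌈x/4⌉ m 0 ⟩
  m + 0            ≡⟨ +-identityʳ m ⟩
  m                ∎

m≤⌈m*4+x/4⌉ : ∀ m x → m ≤ ⌈ m * 4 + x /4⌉
m≤⌈m*4+x/4⌉ m x = ≤-trans (m≤m+n m ⌈ x /4⌉) (≤-reflexive (sym (⌈m*4+x/4⌉≡m+⌈x/4⌉ m x)))

m≡m/4*4+m%4 : ∀ m → m ≡ m / 4 * 4 + m % 4
m≡m/4*4+m%4 m = trans (m≡m%n+[m/n]*n m 4) (+-comm (m % 4) _)

-- Distances in C(n, ±{1,2,3,4})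

arc : ℕ → ℕ → ℕ
arc n d = d ⊓ (n ∸ d)

-- profile n t i is the distance from the vertex a + i to the landmark a + t.
profile : ℕ → ℕ → ℕ → ℕ
profile n t i = ⌈ arc n ∣ t - i ∣ /4⌉

module Cycle (n : ℕ) .{{_ : NonZero n}} (4<n : 4 < n) where

  open Circ n

  toℕ-⊕ : ∀ u j → toℕ (u ⊕ j) ≡ (toℕ u + j) % n
  toℕ-⊕ u j = toℕ-fromℕ< _

  ⊕-≡-by-toℕ : ∀ {u v} j → (toℕ u + j) % n ≡ toℕ v → u ⊕ j ≡ v
  ⊕-≡-by-toℕ {u} j eq = toℕ-injective (trans (toℕ-⊕ u j) eq)

  toℕ+complement : ∀ u → toℕ u + (n ∸ toℕ u) ≡ n
  toℕ+complement u = m+[n∸m]≡n (<⇒≤ (toℕ<n u))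

  [m%n+k]%n≡[m+k]%n : ∀ m k → (m % n + k) % n ≡ (m + k) % n
  [m%n+k]%n≡[m+k]%n m k = begin
    (m % n + k) % n          ≡⟨ %-distribˡ-+ (m % n) k n ⟩
    (m % n % n + k % n) % n  ≡⟨ cong (λ x → (x + k % n) % n) (m%n%n≡m%n m n) ⟩
    (m % n + k % n) % n      ≡⟨ %-distribˡ-+ m k n ⟨
    (m + k) % n              ∎

  ⊕-assoc : ∀ u i j → (u ⊕ i) ⊕ j ≡ u ⊕ (i + j)
  ⊕-assoc u i j = ⊕-≡-by-toℕ j (begin
    (toℕ (u ⊕ i) + j) % n      ≡⟨ cong (λ x → (x + j) % n) (toℕ-⊕ u i) ⟩
    ((toℕ u + i) % n + j) % n  ≡⟨ [m%n+k]%n≡[m+k]%n (toℕ u + i) j ⟩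
    (toℕ u + i + j) % n        ≡⟨ cong (_% n) (+-assoc (toℕ u) i j) ⟩
    (toℕ u + (i + j)) % n      ≡⟨ toℕ-⊕ u (i + j) ⟨
    toℕ (u ⊕ (i + j))          ∎)

  ⊕-identityʳ : ∀ u → u ⊕ 0 ≡ u
  ⊕-identityʳ u = ⊕-≡-by-toℕ 0 (trans (cong (_% n) (+-identityʳ (toℕ u))) (m<n⇒m%n≡m (toℕ<n u)))

  ⊕-n : ∀ u → u ⊕ n ≡ u
  ⊕-n u = ⊕-≡-by-toℕ n (trans ([m+n]%n≡m%n (toℕ u) n) (m<n⇒m%n≡m (toℕ<n u)))

  ⊕-% : ∀ u j → u ⊕ (j % n) ≡ u ⊕ j
  ⊕-% u j = ⊕-≡-by-toℕ (j % n) (begin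
    (toℕ u + j % n) % n  ≡⟨ cong (_% n) (+-comm (toℕ u) (j % n)) ⟩
    (j % n + toℕ u) % n  ≡⟨ [m%n+k]%n≡[m+k]%n j (toℕ u) ⟩
    (j + toℕ u) % n      ≡⟨ cong (_% n) (+-comm j (toℕ u)) ⟩
    (toℕ u + j) % n      ≡⟨ toℕ-⊕ u j ⟨
    toℕ (u ⊕ j)          ∎)

  ⊕-complement : ∀ u {i j} → i + j ≡ n → (u ⊕ i) ⊕ j ≡ u
  ⊕-complement u {i} {j} i+j≡n = trans (⊕-assoc u i j) (trans (cong (u ⊕_) i+j≡n) (⊕-n u))

  ⊕-cancelʳ : ∀ {u v} j → u ⊕ j ≡ v ⊕ j → u ≡ v
  ⊕-cancelʳ {u} {v} j eq = begin
    u                            ≡⟨ ⊕-complement u j%n+[n∸j%n]≡n ⟨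
    (u ⊕ (j % n)) ⊕ (n ∸ j % n)  ≡⟨ cong (_⊕ (n ∸ j % n)) (trans (⊕-% u j) (trans eq (sym (⊕-% v j)))) ⟩
    (v ⊕ (j % n)) ⊕ (n ∸ j % n)  ≡⟨ ⊕-complement v j%n+[n∸j%n]≡n ⟩
    v                            ∎
    where j%n+[n∸j%n]≡n = m+[n∸m]≡n (m%n≤n j n)

  ⊕-cancel-≤ : ∀ {u w i j} → u ⊕ i ≡ w ⊕ j → i ≤ j → u ≡ w ⊕ (j ∸ i)
  ⊕-cancel-≤ {u} {w} {i} {j} eq i≤j = ⊕-cancelʳ i (begin
    u ⊕ i              ≡⟨ eq ⟩
    w ⊕ j              ≡⟨ cong (w ⊕_) (m∸n+n≡m i≤j) ⟨
    w ⊕ (j ∸ i + i)    ≡⟨ ⊕-assoc w (j ∸ i) i ⟨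
    (w ⊕ (j ∸ i)) ⊕ i  ∎)

  diff-⊕ : ∀ u j → diff u (u ⊕ j) ≡ j % n
  diff-⊕ u j = begin
    (toℕ (u ⊕ j) + (n ∸ toℕ u)) % n      ≡⟨ cong (λ x → (x + (n ∸ toℕ u)) % n) (toℕ-⊕ u j) ⟩
    ((toℕ u + j) % n + (n ∸ toℕ u)) % n  ≡⟨ [m%n+k]%n≡[m+k]%n (toℕ u + j) (n ∸ toℕ u) ⟩
    (toℕ u + j + (n ∸ toℕ u)) % n        ≡⟨ cong (λ x → (x + (n ∸ toℕ u)) % n) (+-comm (toℕ u) j) ⟩
    (j + toℕ u + (n ∸ toℕ u)) % n        ≡⟨ cong (_% n) (+-assoc j (toℕ u) (n ∸ toℕ u)) ⟩
    (j + (toℕ u + (n ∸ toℕ u))) % n      ≡⟨ cong (λ x → (j + x) % n) (toℕ+complement u) ⟩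
    (j + n) % n                          ≡⟨ [m+n]%n≡m%n j n ⟩
    j % n                                ∎

  ⊕-diff : ∀ u x → u ⊕ diff u x ≡ x
  ⊕-diff u x = trans (⊕-% u _) (⊕-≡-by-toℕ {u} (toℕ x + (n ∸ toℕ u)) (begin
    (toℕ u + (toℕ x + (n ∸ toℕ u))) % n  ≡⟨ cong (_% n) (+-assoc (toℕ u) (toℕ x) _) ⟨
    (toℕ u + toℕ x + (n ∸ toℕ u)) % n    ≡⟨ cong (λ y → (y + (n ∸ toℕ u)) % n) (+-comm (toℕ u) (toℕ x)) ⟩
    (toℕ x + toℕ u + (n ∸ toℕ u)) % n    ≡⟨ cong (_% n) (+-assoc (toℕ x) (toℕ u) _) ⟩
    (toℕ x + (toℕ u + (n ∸ toℕ u))) % n  ≡⟨ cong (λ y → (toℕ x + y) % n) (toℕ+complement u) ⟩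
    (toℕ x + n) % n                      ≡⟨ [m+n]%n≡m%n (toℕ x) n ⟩
    toℕ x % n                            ≡⟨ m<n⇒m%n≡m (toℕ<n x) ⟩
    toℕ x                                ∎))

  ⊕-injectiveʳ : ∀ a {i j} → i < n → j < n → a ⊕ i ≡ a ⊕ j → i ≡ j
  ⊕-injectiveʳ a {i} {j} i<n j<n eq = begin
    i               ≡⟨ m<n⇒m%n≡m i<n ⟨
    i % n           ≡⟨ diff-⊕ a i ⟨
    diff a (a ⊕ i)  ≡⟨ cong (diff a) eq ⟩
    diff a (a ⊕ j)  ≡⟨ diff-⊕ a j ⟩
    j % n           ≡⟨ m<n⇒m%n≡m j<n ⟩
    j               ∎

  ⊕-step-irreflexive : ∀ u (s : Fin 4) → u ≢ u ⊕ suc (toℕ s)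
  ⊕-step-irreflexive u s eq = 0≢1+n (⊕-injectiveʳ u (≤-<-trans z≤n step<n) step<n (trans (⊕-identityʳ u) eq))
    where step<n = ≤-<-trans (toℕ<n s) 4<n

  adj-⊕ : ∀ u (s : Fin 4) → Adj u (u ⊕ suc (toℕ s))
  adj-⊕ u s = ⊕-step-irreflexive u s , suc (toℕ s) , (s≤s z≤n , toℕ<n s) , inj₁ (diff-⊕ u _)

  adj-⊖ : ∀ u (s : Fin 4) → Adj (u ⊕ suc (toℕ s)) u
  adj-⊖ u s = (λ eq → ⊕-step-irreflexive u s (sym eq)) , suc (toℕ s) , (s≤s z≤n , toℕ<n s) , inj₂ (begin
    diff v u                      ≡⟨ cong (diff v) (⊕-complement u (m+[n∸m]≡n (<⇒≤ step<n))) ⟨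
    diff v (v ⊕ (n ∸ suc (toℕ s))) ≡⟨ diff-⊕ v _ ⟩
    (n ∸ suc (toℕ s)) % n          ≡⟨ cong (λ x → (n ∸ x) % n) (m<n⇒m%n≡m step<n) ⟨
    (n ∸ suc (toℕ s) % n) % n      ∎)
    where
    v = u ⊕ suc (toℕ s)
    step<n = ≤-<-trans (toℕ<n s) 4<n

  Near : Fin n → Fin n → ℕ → Set
  Near u x d = ∃ λ j → j ≤ d × (x ≡ u ⊕ j ⊎ u ≡ x ⊕ j)

  near-mono : ∀ {u x d d′} → d ≤ d′ → Near u x d → Near u x d′
  near-mono d≤d′ (j , j≤d , p) = j , ≤-trans j≤d d≤d′ , p

  near-from-source : ∀ v i j → Near (v ⊕ i) (v ⊕ j) (i + j)
  near-from-source v i j with ≤-total i j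
  ... | inj₁ i≤j = j ∸ i , ≤-trans (m∸n≤m j i) (m≤n+m j i) ,
                   inj₁ (sym (trans (⊕-assoc v i (j ∸ i)) (cong (v ⊕_) (m+[n∸m]≡n i≤j))))
  ... | inj₂ j≤i = i ∸ j , ≤-trans (m∸n≤m i j) (m≤m+n i j) ,
                   inj₂ (sym (trans (⊕-assoc v j (i ∸ j)) (cong (v ⊕_) (m+[n∸m]≡n j≤i))))

  near-from-target : ∀ {u w i j} → u ⊕ i ≡ w ⊕ j → Near u w (i + j)
  near-from-target {i = i} {j} eq with ≤-total i j
  ... | inj₁ i≤j = j ∸ i , ≤-trans (m∸n≤m j i) (m≤n+m j i) , inj₂ (⊕-cancel-≤ eq i≤j)
  ... | inj₂ j≤i = i ∸ j , ≤-trans (m∸n≤m i j) (m≤m+n i j) , inj₁ (⊕-cancel-≤ (sym eq) j≤i)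

  near-trans : ∀ {u v w d e} → Near u v d → Near v w e → Near u w (d + e)
  near-trans {u} (i , i≤d , inj₁ refl) (j , j≤e , inj₁ refl) =
    i + j , +-mono-≤ i≤d j≤e , inj₁ (⊕-assoc u i j)
  near-trans {w = w} {d} {e} (i , i≤d , inj₂ refl) (j , j≤e , inj₂ refl) =
    j + i , ≤-trans (+-mono-≤ j≤e i≤d) (≤-reflexive (+-comm e d)) , inj₂ (⊕-assoc w j i)
  near-trans (i , i≤d , inj₁ refl) (j , j≤e , inj₂ eq) =
    near-mono (+-mono-≤ i≤d j≤e) (near-from-target eq)
  near-trans {v = v} (i , i≤d , inj₂ refl) (j , j≤e , inj₁ refl) =
    near-mono (+-mono-≤ i≤d j≤e) (near-from-source v i j)

  adj⇒near : ∀ {u v} → Adj u v → Near u v 4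
  adj⇒near {u} {v} (_ , s , (_ , s≤4) , inj₁ eq) = s % n , ≤-trans (m%n≤m s n) s≤4 , inj₁ (begin
    v               ≡⟨ ⊕-diff u v ⟨
    u ⊕ diff u v    ≡⟨ cong (u ⊕_) eq ⟩
    u ⊕ (s % n)     ∎)
  adj⇒near {u} {v} (_ , s , (_ , s≤4) , inj₂ eq) = s % n , ≤-trans (m%n≤m s n) s≤4 , inj₂ (begin
    u                            ≡⟨ ⊕-complement u (m∸n+n≡m (m%n≤n s n)) ⟨
    (u ⊕ (n ∸ s % n)) ⊕ (s % n)  ≡⟨ cong (_⊕ (s % n)) (⊕-% u _) ⟨
    (u ⊕ ((n ∸ s % n) % n)) ⊕ (s % n) ≡⟨ cong (λ x → (u ⊕ x) ⊕ (s % n)) eq ⟨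
    (u ⊕ diff u v) ⊕ (s % n)     ≡⟨ cong (_⊕ (s % n)) (⊕-diff u v) ⟩
    v ⊕ (s % n)                  ∎)

  walk⇒near : ∀ {u x m} → Walk u x m → Near u x (m * 4)
  walk⇒near {u} here        = 0 , z≤n , inj₁ (sym (⊕-identityʳ u))
  walk⇒near (step adj walk) = near-trans (adj⇒near adj) (walk⇒near walk)

  cyc : Fin n → Fin n → ℕ
  cyc u x = diff u x ⊓ diff x u

  δ : Fin n → Fin n → ℕ
  δ u x = ⌈ cyc u x /4⌉

  near⇒cyc≤ : ∀ {u x d} → Near u x d → cyc u x ≤ d
  near⇒cyc≤ {u} (j , j≤d , inj₁ refl) =
    ≤-trans (m⊓n≤m _ _) (≤-trans (≤-reflexive (diff-⊕ u j)) (≤-trans (m%n≤m j n) j≤d))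
  near⇒cyc≤ {x = x} (j , j≤d , inj₂ refl) =
    ≤-trans (m⊓n≤n _ _) (≤-trans (≤-reflexive (diff-⊕ x j)) (≤-trans (m%n≤m j n) j≤d))

  walk⇒δ≤ : ∀ {u x m} → Walk u x m → δ u x ≤ m
  walk⇒δ≤ {m = m} walk =
    ≤-trans (⌈/4⌉-mono-≤ (near⇒cyc≤ (walk⇒near walk))) (≤-reflexive (⌈m*4/4⌉≡m m))

  walk-⊕ : ∀ u j → Walk u (u ⊕ j) ⌈ j /4⌉
  walk-⊕ u 0 = subst (λ v → Walk u v 0) (sym (⊕-identityʳ u)) here
  walk-⊕ u 1 = step (adj-⊕ u (# 0)) here
  walk-⊕ u 2 = step (adj-⊕ u (# 1)) here
  walk-⊕ u 3 = step (adj-⊕ u (# 2)) here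
  walk-⊕ u 4 = step (adj-⊕ u (# 3)) here
  walk-⊕ u (suc (suc (suc (suc j@(suc _))))) =
    subst₂ (Walk u) (⊕-assoc u 4 j) (sym (⌈m*4+x/4⌉≡m+⌈x/4⌉ 1 j))
      (step (adj-⊕ u (# 3)) (walk-⊕ (u ⊕ 4) j))

  walk-⊖ : ∀ u j → Walk (u ⊕ j) u ⌈ j /4⌉
  walk-⊖ u 0 = subst (λ v → Walk v u 0) (sym (⊕-identityʳ u)) here
  walk-⊖ u 1 = step (adj-⊖ u (# 0)) here
  walk-⊖ u 2 = step (adj-⊖ u (# 1)) here
  walk-⊖ u 3 = step (adj-⊖ u (# 2)) here
  walk-⊖ u 4 = step (adj-⊖ u (# 3)) here
  walk-⊖ u (suc (suc (suc (suc j@(suc _))))) =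
    subst₂ (λ v m → Walk v u m) (trans (⊕-assoc u j 4) (cong (u ⊕_) (+-comm j 4)))
      (sym (⌈m*4+x/4⌉≡m+⌈x/4⌉ 1 j))
      (step (adj-⊖ (u ⊕ j) (# 3)) (walk-⊖ u j))

  δ-walk : ∀ u x → Walk u x (δ u x)
  δ-walk u x with ⊓-sel (diff u x) (diff x u)
  ... | inj₁ cyc≡diff = subst₂ (Walk u) (⊕-diff u x) (cong ⌈_/4⌉ (sym cyc≡diff)) (walk-⊕ u (diff u x))
  ... | inj₂ cyc≡diff = subst₂ (λ v m → Walk v x m) (⊕-diff x u) (cong ⌈_/4⌉ (sym cyc≡diff))
                          (walk-⊖ x (diff x u))

  dist-δ : ∀ u x → Dist u x (δ u x)
  dist-δ u x = δ-walk u x , λ _ → walk⇒δ≤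

  dist⇒≡δ : ∀ {u x m} → Dist u x m → m ≡ δ u x
  dist⇒≡δ {u} {x} (walk , minimal) = ≤-antisym (minimal _ (δ-walk u x)) (walk⇒δ≤ walk)

  sameRep-by-δ : ∀ X u v → (∀ x → x ∈ₛ X → δ u x ≡ δ v x) → SameRep X u v
  sameRep-by-δ X u v δ≡ x x∈X m = mk⇔
    (λ d → subst (Dist v x) (sym (trans (dist⇒≡δ d) (δ≡ x x∈X))) (dist-δ v x))
    (λ d → subst (Dist u x) (sym (trans (dist⇒≡δ d) (sym (δ≡ x x∈X)))) (dist-δ u x))

  cyc-⊕ : ∀ b {d} → d < n → cyc b (b ⊕ d) ≡ arc n d
  cyc-⊕ b {d} d<n = begin
    diff b (b ⊕ d) ⊓ diff (b ⊕ d) b  ≡⟨ cong₂ _⊓_ (trans (diff-⊕ b d) (m<n⇒m%n≡m d<n)) backward ⟩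
    d ⊓ ((n ∸ d) % n)                ≡⟨ arc-% d d<n ⟩
    d ⊓ (n ∸ d)                      ∎
    where
    backward : diff (b ⊕ d) b ≡ (n ∸ d) % n
    backward = trans (cong (diff (b ⊕ d)) (sym (⊕-complement b (m+[n∸m]≡n (<⇒≤ d<n)))))
                     (diff-⊕ (b ⊕ d) (n ∸ d))
    arc-% : ∀ d → d < n → d ⊓ ((n ∸ d) % n) ≡ d ⊓ (n ∸ d)
    arc-% zero    _   = refl
    arc-% (suc d) d<n = cong (suc d ⊓_) (m<n⇒m%n≡m (∸-monoʳ-< {o = 0} (s≤s z≤n) (<⇒≤ d<n)))

  cyc-offsets : ∀ a {i t} → i ≤ t → t < n → cyc (a ⊕ i) (a ⊕ t) ≡ arc n (t ∸ i)
  cyc-offsets a {i} {t} i≤t t<n = begin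
    cyc (a ⊕ i) (a ⊕ t)                ≡⟨ cong (cyc (a ⊕ i)) a⊕t≡ ⟩
    cyc (a ⊕ i) ((a ⊕ i) ⊕ (t ∸ i))    ≡⟨ cyc-⊕ (a ⊕ i) (≤-<-trans (m∸n≤m t i) t<n) ⟩
    arc n (t ∸ i)                      ∎
    where a⊕t≡ = sym (trans (⊕-assoc a i (t ∸ i)) (cong (a ⊕_) (m+[n∸m]≡n i≤t)))

  δ-offsets : ∀ a {t i} → t < n → i < n → δ (a ⊕ i) (a ⊕ t) ≡ profile n t i
  δ-offsets a {t} {i} t<n i<n with ≤-total i t
  ... | inj₁ i≤t = cong ⌈_/4⌉ (begin
    cyc (a ⊕ i) (a ⊕ t)  ≡⟨ cyc-offsets a i≤t t<n ⟩
    arc n (t ∸ i)        ≡⟨ cong (arc n) (m≤n⇒∣n-m∣≡n∸m i≤t) ⟨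
    arc n ∣ t - i ∣      ∎)
  ... | inj₂ t≤i = cong ⌈_/4⌉ (begin
    cyc (a ⊕ i) (a ⊕ t)  ≡⟨ ⊓-comm _ _ ⟩
    cyc (a ⊕ t) (a ⊕ i)  ≡⟨ cyc-offsets a t≤i i<n ⟩
    arc n (i ∸ t)        ≡⟨ cong (arc n) (m≤n⇒∣m-n∣≡n∸m t≤i) ⟨
    arc n ∣ t - i ∣      ∎)

  equidistant-from-landmark : ∀ a {i j} x → i < n → j < n →
    profile n (diff a x) i ≡ profile n (diff a x) j → δ (a ⊕ i) x ≡ δ (a ⊕ j) x
  equidistant-from-landmark a {i} {j} x i<n j<n eq =
    subst (λ z → δ (a ⊕ i) z ≡ δ (a ⊕ j) z) (⊕-diff a x)
      (trans (δ-offsets a t<n i<n) (trans eq (sym (δ-offsets a t<n j<n))))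
    where t<n = m%n<n _ n

-- Landmark profiles on the window a, …, a + 8

Profile : Set
Profile = ℕ → ℕ

-- the profile of a landmark inside the window, when n is large
innerProfile : ℕ → Profile
innerProfile t i = ⌈ ∣ t - i ∣ /4⌉

-- the profile of a landmark lying A steps beyond a + 8 and B steps before a
outerProfile : ℕ → ℕ → Profile
outerProfile A B i = ⌈ A + (8 ∸ i) /4⌉ ⊓ ⌈ B + i /4⌉

infix 4 _≈_
_≈_ : Profile → Profile → Set
g ≈ h = ∃ λ m → ∀ i → i ≤ 8 → g i ≡ m + h i

≈-trans : ∀ {f g h} → f ≈ g → g ≈ h → f ≈ h
≈-trans {f} {g} {h} (m , f≡) (m′ , g≡) = m + m′ , λ i i≤8 → begin
  f i              ≡⟨ f≡ i i≤8 ⟩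
  m + g i          ≡⟨ cong (m +_) (g≡ i i≤8) ⟩
  m + (m′ + h i)   ≡⟨ +-assoc m m′ (h i) ⟨
  m + m′ + h i     ∎

agree⇒≈ : ∀ {g h} → (∀ i → i ≤ 8 → g i ≡ h i) → g ≈ h
agree⇒≈ g≡h = 0 , g≡h

profile-inner : ∀ {n t i} → 16 ≤ n → t ≤ 8 → i ≤ 8 → profile n t i ≡ innerProfile t i
profile-inner {n} {t} {i} 16≤n t≤8 i≤8 =
  cong ⌈_/4⌉ (m≤n⇒m⊓n≡m (≤-trans d≤8 (∸-mono 16≤n d≤8)))
  where d≤8 = ≤-trans (∣m-n∣≤m⊔n t i) (⊔-lub t≤8 i≤8)

profile-outer : ∀ {n t i} → 8 ≤ t → t ≤ n → i ≤ 8 → profile n t i ≡ outerProfile (t ∸ 8) (n ∸ t) i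
profile-outer {n} {t} {i} 8≤t t≤n i≤8 = begin
  ⌈ arc n ∣ t - i ∣ /4⌉              ≡⟨ cong (λ d → ⌈ arc n d /4⌉) (m≤n⇒∣n-m∣≡n∸m i≤t) ⟩
  ⌈ (t ∸ i) ⊓ (n ∸ (t ∸ i)) /4⌉      ≡⟨ ⌈/4⌉-distrib-⊓ (t ∸ i) (n ∸ (t ∸ i)) ⟩
  ⌈ t ∸ i /4⌉ ⊓ ⌈ n ∸ (t ∸ i) /4⌉    ≡⟨ cong₂ (λ x y → ⌈ x /4⌉ ⊓ ⌈ y /4⌉) towards-8 towards-0 ⟩
  outerProfile (t ∸ 8) (n ∸ t) i     ∎
  where
  i≤t = ≤-trans i≤8 8≤t
  towards-8 : t ∸ i ≡ t ∸ 8 + (8 ∸ i)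
  towards-8 = begin
    t ∸ i            ≡⟨ cong (_∸ i) (m∸n+n≡m 8≤t) ⟨
    t ∸ 8 + 8 ∸ i    ≡⟨ +-∸-assoc (t ∸ 8) i≤8 ⟩
    t ∸ 8 + (8 ∸ i)  ∎
  towards-0 : n ∸ (t ∸ i) ≡ n ∸ t + i
  towards-0 = begin
    n ∸ (t ∸ i)            ≡⟨ cong (_∸ (t ∸ i)) (m∸n+n≡m t≤n) ⟨
    n ∸ t + t ∸ (t ∸ i)    ≡⟨ +-∸-assoc (n ∸ t) (m∸n≤m t i) ⟩
    n ∸ t + (t ∸ (t ∸ i))  ≡⟨ cong (n ∸ t +_) (m∸[m∸n]≡n i≤t) ⟩
    n ∸ t + i              ∎

outerProfile-mirror : ∀ A B {i} → i ≤ 8 → outerProfile A B i ≡ outerProfile B A (8 ∸ i)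
outerProfile-mirror A B {i} i≤8 = begin
  ⌈ A + (8 ∸ i) /4⌉ ⊓ ⌈ B + i /4⌉              ≡⟨ ⊓-comm _ _ ⟩
  ⌈ B + i /4⌉ ⊓ ⌈ A + (8 ∸ i) /4⌉
    ≡⟨ cong (λ j → ⌈ B + j /4⌉ ⊓ ⌈ A + (8 ∸ i) /4⌉) (m∸[m∸n]≡n i≤8) ⟨
  ⌈ B + (8 ∸ (8 ∸ i)) /4⌉ ⊓ ⌈ A + (8 ∸ i) /4⌉  ∎

≈-mirror : ∀ {A B A′ B′} → outerProfile B A ≈ outerProfile B′ A′ → outerProfile A B ≈ outerProfile A′ B′
≈-mirror {A} {B} {A′} {B′} (m , eq) = m , λ i i≤8 → begin
  outerProfile A B i              ≡⟨ outerProfile-mirror A B i≤8 ⟩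
  outerProfile B A (8 ∸ i)        ≡⟨ eq (8 ∸ i) (m∸n≤m 8 i) ⟩
  m + outerProfile B′ A′ (8 ∸ i)  ≡⟨ cong (m +_) (outerProfile-mirror A′ B′ i≤8) ⟨
  m + outerProfile A′ B′ i        ∎

outerProfile-shift : ∀ m A B i → outerProfile (m * 4 + A) (m * 4 + B) i ≡ m + outerProfile A B i
outerProfile-shift m A B i = begin
  ⌈ m * 4 + A + (8 ∸ i) /4⌉ ⊓ ⌈ m * 4 + B + i /4⌉  ≡⟨ cong₂ _⊓_ (shifted A (8 ∸ i)) (shifted B i) ⟩
  (m + ⌈ A + (8 ∸ i) /4⌉) ⊓ (m + ⌈ B + i /4⌉)      ≡⟨ +-distribˡ-⊓ m _ _ ⟨
  m + outerProfile A B i                            ∎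
  where
  shifted : ∀ x y → ⌈ m * 4 + x + y /4⌉ ≡ m + ⌈ x + y /4⌉
  shifted x y = trans (cong ⌈_/4⌉ (+-assoc (m * 4) x y)) (⌈m*4+x/4⌉≡m+⌈x/4⌉ m (x + y))

-- Once B is far beyond A, the landmark is reached through a + 8 from the whole window.
outerProfile-far : ∀ {α} e x i → α < 4 → 3 ≤ e → outerProfile α (e * 4 + x) i ≡ ⌈ α + (8 ∸ i) /4⌉
outerProfile-far {α} e x i α<4 3≤e = m≤n⇒m⊓n≡m (≤-trans window≤3 (≤-trans 3≤e e≤))
  where
  window≤3 : ⌈ α + (8 ∸ i) /4⌉ ≤ 3
  window≤3 = ⌈/4⌉-mono-≤ (+-mono-≤ (≤-pred α<4) (m∸n≤m 8 i))
  e≤ : e ≤ ⌈ e * 4 + x + i /4⌉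
  e≤ = subst (λ y → e ≤ ⌈ y /4⌉) (sym (+-assoc (e * 4) x i)) (m≤⌈m*4+x/4⌉ e (x + i))

outerProfile-clamp : ∀ {α} d x i → α < 4 → outerProfile α (d * 4 + x) i ≡ outerProfile α ((d ⊓ 3) * 4 + x) i
outerProfile-clamp {α} d x i α<4 with ≤-total d 3
... | inj₁ d≤3 = cong (λ e → outerProfile α (e * 4 + x) i) (sym (m≤n⇒m⊓n≡m d≤3))
... | inj₂ 3≤d = trans (outerProfile-far d x i α<4 3≤d)
                       (sym (outerProfile-far (d ⊓ 3) x i α<4 (≤-reflexive (sym (m≥n⇒m⊓n≡n 3≤d)))))

outer-normal-formʳ : ∀ A B → A / 4 ≤ B / 4 →
  ∃ λ e → e < 4 × outerProfile A B ≈ outerProfile (A % 4) (e * 4 + B % 4)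
outer-normal-formʳ A B a≤b = d ⊓ 3 , s≤s (m⊓n≤n d 3) , a , λ i i≤8 → begin
  outerProfile A B i                                         ≡⟨ cong₂ (λ A′ B′ → outerProfile A′ B′ i) (m≡m/4*4+m%4 A) B≡ ⟩
  outerProfile (a * 4 + A % 4) (a * 4 + (d * 4 + B % 4)) i  ≡⟨ outerProfile-shift a _ _ i ⟩
  a + outerProfile (A % 4) (d * 4 + B % 4) i                ≡⟨ cong (a +_) (outerProfile-clamp d (B % 4) i (m%n<n A 4)) ⟩
  a + outerProfile (A % 4) ((d ⊓ 3) * 4 + B % 4) i          ∎
  where
  a = A / 4
  d = B / 4 ∸ a
  B≡ : B ≡ a * 4 + (d * 4 + B % 4)
  B≡ = begin
    B                           ≡⟨ m≡m/4*4+m%4 B ⟩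
    B / 4 * 4 + B % 4           ≡⟨ cong (λ b → b * 4 + B % 4) (m+[n∸m]≡n a≤b) ⟨
    (a + d) * 4 + B % 4         ≡⟨ cong (_+ B % 4) (*-distribʳ-+ 4 a d) ⟩
    a * 4 + d * 4 + B % 4       ≡⟨ +-assoc (a * 4) (d * 4) (B % 4) ⟩
    a * 4 + (d * 4 + B % 4)     ∎

outer-normal-form : ∀ A B →
  (∃ λ e → e < 4 × outerProfile A B ≈ outerProfile (A % 4) (e * 4 + B % 4)) ⊎
  (∃ λ e → e < 4 × outerProfile A B ≈ outerProfile (e * 4 + A % 4) (B % 4))
outer-normal-form A B with ≤-total (A / 4) (B / 4)
... | inj₁ a≤b = inj₁ (outer-normal-formʳ A B a≤b)
... | inj₂ b≤a with outer-normal-formʳ B A b≤a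
...   | e , e<4 , B,A≈ = inj₂ (e , e<4 , ≈-mirror {A} {B} {e * 4 + A % 4} {B % 4} B,A≈)

outer-residue : ∀ k r {n t} → n ≡ 8 * suc k + r → 8 ≤ t → t ≤ n →
  ((t ∸ 8) % 4 + (n ∸ t) % 4) % 4 ≡ r % 4
outer-residue k r {n} {t} n≡ 8≤t t≤n = begin
  ((t ∸ 8) % 4 + (n ∸ t) % 4) % 4  ≡⟨ %-distribˡ-+ (t ∸ 8) (n ∸ t) 4 ⟨
  (t ∸ 8 + (n ∸ t)) % 4            ≡⟨ cong (_% 4) A+B≡ ⟩
  (r + k * 2 * 4) % 4              ≡⟨ [m+kn]%n≡m%n r (k * 2) 4 ⟩
  r % 4                            ∎
  where
  n≡8+ : ∀ k r → 8 * suc k + r ≡ 8 + (r + k * 2 * 4)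
  n≡8+ = solve-∀
  A+B≡ : t ∸ 8 + (n ∸ t) ≡ r + k * 2 * 4
  A+B≡ = begin
    t ∸ 8 + (n ∸ t)          ≡⟨ +-∸-comm (n ∸ t) 8≤t ⟨
    t + (n ∸ t) ∸ 8          ≡⟨ cong (_∸ 8) (trans (m+[n∸m]≡n t≤n) (trans n≡ (n≡8+ k r))) ⟩
    8 + (r + k * 2 * 4) ∸ 8  ≡⟨ m+n∸m≡n 8 _ ⟩
    r + k * 2 * 4            ∎

pairsWithin : List ℕ → List (ℕ × ℕ)
pairsWithin []       = []
pairsWithin (x ∷ xs) = map (x ,_) xs ++ pairsWithin xs

∈-pairsWithin⁻ : ∀ {xs i j} → (i , j) ∈ pairsWithin xs → i ∈ xs × j ∈ xs
∈-pairsWithin⁻ {x ∷ xs} ij∈ with ∈-++⁻ (map (x ,_) xs) ij∈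
... | inj₁ ij∈map with ∈-map⁻ (x ,_) ij∈map
...   | _ , j∈ , refl = here refl , there j∈
∈-pairsWithin⁻ {x ∷ xs} ij∈ | inj₂ ij∈rest = Product.map there there (∈-pairsWithin⁻ ij∈rest)

blockOffsets₁ blockOffsets₂ : List ℕ
blockOffsets₁ = 0 ∷ 1 ∷ 2 ∷ []
blockOffsets₂ = 3 ∷ 5 ∷ 6 ∷ 8 ∷ []

blockPairs : List (ℕ × ℕ)
blockPairs = pairsWithin blockOffsets₁ ++ pairsWithin blockOffsets₂

blockPairs-ordered : All (λ (i , j) → i < j × j ≤ 8) blockPairs
blockPairs-ordered = from-yes (All.all? (λ (i , j) → (i <? j) ×-dec (j ≤? 8)) blockPairs)

Blind : Profile → ℕ × ℕ → Set
Blind g (i , j) = g i ≡ g j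

blind-≈ : ∀ {g h i j} → g ≈ h → i ≤ 8 → j ≤ 8 → Blind h (i , j) → Blind g (i , j)
blind-≈ {g} {h} {i} {j} (m , g≡) i≤8 j≤8 hi≡hj = begin
  g i      ≡⟨ g≡ i i≤8 ⟩
  m + h i  ≡⟨ cong (m +_) hi≡hj ⟩
  m + h j  ≡⟨ g≡ j j≤8 ⟨
  g j      ∎

ShareBlindPair : Profile → Profile → Set
ShareBlindPair g h = Any (λ p → Blind g p × Blind h p) blockPairs

shareBlindPair? : ∀ g h → Dec (ShareBlindPair g h)
shareBlindPair? g h = Any.any? (λ (i , j) → (g i ≟ g j) ×-dec (h i ≟ h j)) blockPairs

-- Up to a constant, every landmark profile is one of these (residue r mod 4 picks the outer ones).
canonicalProfiles : ℕ → List Profile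
canonicalProfiles r =
  map innerProfile (upTo 8) ++ map (profile (8 + r)) (upTo 8) ++
  concatMap outerPair (filter (λ (α , β) → (α + β) % 4 ≟ r % 4) (cartesianProduct (upTo 4) (upTo 4)))
  where
  outerPair : ℕ × ℕ → List Profile
  outerPair (α , β) = concatMap (λ e → outerProfile α (e * 4 + β) ∷ outerProfile (e * 4 + α) β ∷ []) (upTo 4)

Listed : ℕ → Profile → Set
Listed r g = Any (λ h → All (λ i → g i ≡ h i) (upTo 9)) (canonicalProfiles r)

listed? : ∀ r g → Dec (Listed r g)
listed? r g = Any.any? (λ h → All.all? (λ i → g i ≟ h i) (upTo 9)) (canonicalProfiles r)

InnerListed ShortCycleListed OuterListed PairwiseShareBlind : ℕ → Set
InnerListed r = All (λ t → Listed r (innerProfile t)) (upTo 8)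
ShortCycleListed r = All (λ t → Listed r (profile (8 + r) t)) (upTo 8)
OuterListed r = All (λ α → All (λ β → All (λ e → (α + β) % 4 ≡ r % 4 →
  Listed r (outerProfile α (e * 4 + β)) × Listed r (outerProfile (e * 4 + α) β)) (upTo 4)) (upTo 4)) (upTo 4)
PairwiseShareBlind r = All (λ g → All (ShareBlindPair g) (canonicalProfiles r)) (canonicalProfiles r)

Certificate : ℕ → Set
Certificate r = InnerListed r × ShortCycleListed r × OuterListed r × PairwiseShareBlind r

certificate? : ∀ r → Dec (Certificate r)
certificate? r =
  All.all? (λ t → listed? r (innerProfile t)) (upTo 8) ×-dec
  All.all? (λ t → listed? r (profile (8 + r) t)) (upTo 8) ×-dec
  All.all? (λ α → All.all? (λ β → All.all? (λ e → ((α + β) % 4 ≟ r % 4) →-dec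
      (listed? r (outerProfile α (e * 4 + β)) ×-dec listed? r (outerProfile (e * 4 + α) β)))
    (upTo 4)) (upTo 4)) (upTo 4) ×-dec
  All.all? (λ g → All.all? (shareBlindPair? g) (canonicalProfiles r)) (canonicalProfiles r)

certificate : ∀ {r} → r ≡ 2 ⊎ r ≡ 5 → Certificate r
certificate (inj₁ refl) = from-yes (certificate? 2)
certificate (inj₂ refl) = from-yes (certificate? 5)

Represented : ℕ → Profile → Set
Represented r g = ∃ λ h → h ∈ canonicalProfiles r × g ≈ h

listed⇒represented : ∀ {r g} → Listed r g → Represented r g
listed⇒represented listed with find listed
... | h , h∈ , agree = h , h∈ , agree⇒≈ (λ i i≤8 → All.lookup agree (∈-upTo⁺ (s≤s i≤8)))

represented-≈ : ∀ {r g h} → g ≈ h → Represented r h → Represented r g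
represented-≈ g≈h (k , k∈ , h≈k) = k , k∈ , ≈-trans g≈h h≈k

outerListed-lookup : ∀ {r α β e} → OuterListed r → α < 4 → β < 4 → e < 4 → (α + β) % 4 ≡ r % 4 →
  Listed r (outerProfile α (e * 4 + β)) × Listed r (outerProfile (e * 4 + α) β)
outerListed-lookup outer α<4 β<4 e<4 =
  All.lookup (All.lookup (All.lookup outer (∈-upTo⁺ α<4)) (∈-upTo⁺ β<4)) (∈-upTo⁺ e<4)

outer-represented : ∀ {r} A B → OuterListed r → (A % 4 + B % 4) % 4 ≡ r % 4 → Represented r (outerProfile A B)
outer-represented A B outer residue with outer-normal-form A B
... | inj₁ (e , e<4 , A,B≈) =
  represented-≈ A,B≈ (listed⇒represented (proj₁ (outerListed-lookup outer (m%n<n A 4) (m%n<n B 4) e<4 residue)))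
... | inj₂ (e , e<4 , A,B≈) =
  represented-≈ A,B≈ (listed⇒represented (proj₂ (outerListed-lookup outer (m%n<n A 4) (m%n<n B 4) e<4 residue)))

landmark-represented : ∀ {k r n t} → Certificate r → n ≡ 8 * suc k + r → t < n → Represented r (profile n t)
landmark-represented {t = t} _ _ _ with t <? 8
landmark-represented {zero} {r} {n} {t} (_ , short , _) n≡ t<n | yes t<8 =
  subst (λ m → Represented r (profile m t)) (sym n≡) (listed⇒represented (All.lookup short (∈-upTo⁺ t<8)))
landmark-represented {suc _} {r} (inner , _) n≡ t<n | yes t<8 =
  represented-≈ (agree⇒≈ (λ i → profile-inner 16≤n (<⇒≤ t<8)))
                (listed⇒represented (All.lookup inner (∈-upTo⁺ t<8)))
  where 16≤n = ≤-trans (≤-trans (*-monoʳ-≤ 8 (s≤s (s≤s z≤n))) (m≤m+n _ r)) (≤-reflexive (sym n≡))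
landmark-represented {k} {r} {n} {t} (_ , _ , outer , _) n≡ t<n | no t≮8 =
  represented-≈ (agree⇒≈ (λ i → profile-outer 8≤t (<⇒≤ t<n)))
                (outer-represented (t ∸ 8) (n ∸ t) outer (outer-residue k r n≡ 8≤t (<⇒≤ t<n)))
  where 8≤t = ≮⇒≥ t≮8

landmarks-share-blind-pair : ∀ {k r n t t′} → r ≡ 2 ⊎ r ≡ 5 → n ≡ 8 * suc k + r → t < n → t′ < n →
  ∃ λ p → p ∈ blockPairs × Blind (profile n t) p × Blind (profile n t′) p
landmarks-share-blind-pair r∈ n≡ t<n t′<n
  with certificate r∈
... | cert@(_ , _ , _ , pairwise)
  with landmark-represented cert n≡ t<n | landmark-represented cert n≡ t′<n
... | h , h∈ , t≈h | h′ , h′∈ , t′≈h′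
  with find (All.lookup (All.lookup pairwise h∈) h′∈)
... | (i , j) , ij∈ , blind , blind′ =
  (i , j) , ij∈ , blind-≈ t≈h i≤8 j≤8 blind , blind-≈ t′≈h′ i≤8 j≤8 blind′
  where
  j≤8 = proj₂ (All.lookup blockPairs-ordered ij∈)
  i≤8 = ≤-trans (<⇒≤ (proj₁ (All.lookup blockPairs-ordered ij∈))) j≤8

-- Subsets with at most two elements

elements : ∀ {m} → Subset m → List (Fin m)
elements []            = []
elements (outside ∷ p) = map suc (elements p)
elements (inside ∷ p)  = zero ∷ map suc (elements p)

length-elements : ∀ {m} (p : Subset m) → length (elements p) ≡ ∣ p ∣
length-elements []            = refl
length-elements (outside ∷ p) = trans (length-map suc (elements p)) (length-elements p)
length-elements (inside ∷ p)  = cong suc (trans (length-map suc (elements p)) (length-elements p))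

∈-elements : ∀ {m} {p : Subset m} {z} → z ∈ₛ p → z ∈ elements p
∈-elements {p = inside ∷ p}  here        = here refl
∈-elements {p = outside ∷ p} (there z∈p) = ∈-map⁺ suc (∈-elements z∈p)
∈-elements {p = inside ∷ p}  (there z∈p) = there (∈-map⁺ suc (∈-elements z∈p))

at-most-two : ∀ {a} {A : Set a} (xs : List A) → length xs ≤ 2 → A →
  ∃₂ λ x y → ∀ {z} → z ∈ xs → z ≡ x ⊎ z ≡ y
at-most-two []           _ d = d , d , λ ()
at-most-two (x ∷ [])     _ _ = x , x , λ { (here z≡x) → inj₁ z≡x }
at-most-two (x ∷ y ∷ []) _ _ = x , y , λ { (here z≡x) → inj₁ z≡x ; (there (here z≡y)) → inj₂ z≡y }
at-most-two (_ ∷ _ ∷ _ ∷ _) (s≤s (s≤s ()))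

covered-by-two : ∀ {m} (p : Subset m) → ∣ p ∣ ≤ 2 → Fin m →
  ∃₂ λ x y → ∀ {z} → z ∈ₛ p → z ≡ x ⊎ z ≡ y
covered-by-two p ∣p∣≤2 d with at-most-two (elements p) (subst (_≤ 2) (sym (length-elements p)) ∣p∣≤2) d
... | x , y , covers = x , y , λ z∈p → covers (∈-elements z∈p)

module _ {n} .{{_ : NonZero n}} (8<n : 8 < n) where

  open Circ n
  open Cycle n (≤-<-trans (m≤m+n 4 4) 8<n)

  blockPair-unresolved : ∀ {a X i j} → Resolves2 X (clusterA₁ a) (clusterA₂ a) →
    (i , j) ∈ blockPairs → ¬ SameRep X (a ⊕ i) (a ⊕ j)
  blockPair-unresolved {a} {X} {i} {j} (resolves₁ , resolves₂) ij∈ sameRep =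
    [ separated resolves₁ , separated resolves₂ ]′ (∈-++⁻ (pairsWithin blockOffsets₁) ij∈)
    where
    i<j = proj₁ (All.lookup blockPairs-ordered ij∈)
    j<n = ≤-<-trans (proj₂ (All.lookup blockPairs-ordered ij∈)) 8<n
    a⊕i≢a⊕j : a ⊕ i ≢ a ⊕ j
    a⊕i≢a⊕j eq = <⇒≢ i<j (⊕-injectiveʳ a (<-trans i<j j<n) j<n eq)
    separated : ∀ {offsets} →
      (∀ u v → u ∈ map (a ⊕_) offsets → v ∈ map (a ⊕_) offsets → u ≢ v → ¬ SameRep X u v) →
      (i , j) ∈ pairsWithin offsets → ⊥
    separated resolves ij∈ = let i∈ , j∈ = ∈-pairsWithin⁻ ij∈ in
      resolves _ _ (∈-map⁺ (a ⊕_) i∈) (∈-map⁺ (a ⊕_) j∈) a⊕i≢a⊕j sameRep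

  blockPair-equidistant-from-two : ∀ {k r} → r ≡ 2 ⊎ r ≡ 5 → n ≡ 8 * suc k + r → ∀ a x y →
    ∃ λ ((i , j) : ℕ × ℕ) → (i , j) ∈ blockPairs × ∀ {z} → z ≡ x ⊎ z ≡ y → δ (a ⊕ i) z ≡ δ (a ⊕ j) z
  blockPair-equidistant-from-two r∈ n≡ a x y
    with landmarks-share-blind-pair {t = diff a x} {t′ = diff a y} r∈ n≡ (m%n<n _ n) (m%n<n _ n)
  ... | (i , j) , ij∈ , blind-x , blind-y = (i , j) , ij∈ , λ
    { (inj₁ refl) → equidistant-from-landmark a x i<n j<n blind-x
    ; (inj₂ refl) → equidistant-from-landmark a y i<n j<n blind-y }
    where
    j<n = ≤-<-trans (proj₂ (All.lookup blockPairs-ordered ij∈)) 8<n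
    i<n = <-trans (proj₁ (All.lookup blockPairs-ordered ij∈)) j<n

  no-two-vertices-resolve : ∀ {k r} → r ≡ 2 ⊎ r ≡ 5 → n ≡ 8 * suc k + r → ∀ a X →
    Resolves2 X (clusterA₁ a) (clusterA₂ a) → ¬ (∣ X ∣ ≤ 2)
  no-two-vertices-resolve r∈ n≡ a X resolves ∣X∣≤2 =
    let x , y , X⊆⁅x,y⁆ = covered-by-two X ∣X∣≤2 a
        (i , j) , ij∈ , equidistant = blockPair-equidistant-from-two r∈ n≡ a x y
    in blockPair-unresolved resolves ij∈ (sameRep-by-δ X _ _ λ z z∈X → equidistant (X⊆⁅x,y⁆ z∈X))

lemma3p20 : (k r n : ℕ) .{{_ : NonZero n}} → 1 ≤ k → (r ≡ 2 ⊎ r ≡ 5) → n ≡ 8 * k + r →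
    (a : Fin n) (S X : Subset n) →
    Circ.IsCluster2 n S (Circ.clusterA₁ n a) (Circ.clusterA₂ n a) →
    Circ.Resolves2 n X (Circ.clusterA₁ n a) (Circ.clusterA₂ n a) →
    3 ≤ ∣ X ∣
lemma3p20 (suc k) r n _ r∈ n≡ a S X _ resolves =
  ≮⇒≥ (λ ∣X∣<3 → no-two-vertices-resolve 8<n r∈ n≡ a X resolves (≤-pred ∣X∣<3))
  where
  1≤r : 1 ≤ r
  1≤r = [ (λ { refl → s≤s z≤n }) , (λ { refl → s≤s z≤n }) ]′ r∈
  8<n : 8 < n
  8<n = subst (8 <_) (sym n≡) (+-mono-≤ (m≤m*n 8 (suc k)) 1≤r)
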